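{- Every FDAG $D$ has $\Theta(\#D)$ successors in the FDAG enumeration tree; that is, there are absolute constants $0<c\le C$ such that for every FDAG $D$ the number of FDAGs obtained from $D$ by one application of the branching, elongation or widening rule lies between $c\,\#D$ and $C\,\#D$.
   Context: Trees are finite unordered rooted trees. In a directed multigraph, $\mathrm{child}(v)$ is the multiset of heads of arcs leaving $v$ (with multiplicity); $h(v)=0$ if $v$ has no children, else $1+\max_{u\in\mathrm{child}(v)}h(u)$; $\#D$ is the number of vertices. An irredundant forest is a finite set of trees none of which is isomorphic to a subtree (vertex plus all descendants) of another. The DAG reduction $\mathcal{R}(F)$ has one vertex per isomorphism class of subtrees occurring in $F$, with, from the class of $T[v]$ to a class $c'$, as many arcs as $v$ has children $u$ with $T[u]\in c'$. An FDAG is a directed acyclic multigraph of the form $\mathcal{R}(F)$, $F$ an irredundant forest; equivalently a finite connected directed acyclic multigraph whose distinct vertices have distinct multisets of children. $<_{\mathrm{lex}}$ is the lexicographical order on words (a proper prefix is smaller; otherwise compare at the first differing letter); a word $a_0\cdots a_m$ is decreasing if $a_i\ge a_{i+1}$ for all $i$. $SC(w)$ removes the last letter of a nonempty word. For a bijection $\psi:V(D)\to\{0,\dots,\#D-1\}$, $\mathrm{child}_\psi(v)$ lists $\psi(w)$, $w\in\mathrm{child}(v)$ with multiplicity, in non-increasing order. The canonical ordering of an FDAG is the unique such bijection with $\psi(u)>\psi(v)$ whenever there is an arc $u\to v$, $h(u)>h(v)\Rightarrow\psi(u)>\psi(v)$, and ($h(u)=h(v)$ and $\mathrm{child}_\psi(u)>_{\mathrm{lex}}\mathrm{child}_\psi(v))\Rightarrow\psi(u)>\psi(v)$;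 write $D=(v_0,\dots,v_n)$ with $\psi(v_i)=i$, $\mathcal{A}_==\{\psi(v):h(v)=h(v_n)\}$, $\mathcal{A}_<=\{\psi(v):h(v)<h(v_n)\}$. Expansion rules: (Branching) with $\mathrm{child}_\psi(v_n)=a_0\cdots a_m$, choose $a\in\mathcal{A}_<$ with $a\le a_m$ (any $a\in\mathcal{A}_<$ if the word is empty) and add one arc from $v_n$ to $\psi^{ -1}(a)$. (Elongation) add a new vertex $v_{n+1}$ with exactly one arc, to $\psi^{ -1}(a)$ for some $a\in\mathcal{A}_=$. (Widening) add a new vertex $v_{n+1}$ whose children word is a minimal word of the set of decreasing words $w$ over $\mathcal{A}_<$ with $w>_{\mathrm{lex}}\mathrm{child}_\psi(v_n)$ ($w$ minimal: $w$ is in the set but $SC(w)$ is not). The successors of $D$ in the enumeration tree are the FDAGs obtained from $D$ by one application of one rule. -}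

module Defs where

open import Data.Nat using (ℕ; zero; suc; _⊔_; _≤_; _≤ᵇ_) renaming (_<_ to _<ℕ_)
open import Data.Fin using (Fin; zero; suc; toℕ; fromℕ; _≟_; _<_)
open import Data.List using (List; []; _∷_; map; foldr)
open import Data.List.Membership.Propositional using (_∈_)
open import Data.List.Relation.Unary.All using (All)
open import Data.List.Relation.Unary.Any using (Any)
open import Data.List.Relation.Binary.Permutation.Propositional using (_↭_)
open import Data.Product using (Σ; ∃; _×_; _,_)
open import Data.Sum using (_⊎_)
open import Data.Unit using (⊤)
open import Data.Empty using (⊥)
open import Data.Bool using (if_then_else_)
open import Relation.Nullary using (¬_; yes; no)
open import Relation.Binary.PropositionalEquality using (_≡_; _≢_; setoid)
open import Relation.Binary.Construct.Closure.Transitive using (TransClosure)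
open import Relation.Binary.Construct.Closure.Equivalence using (EqClosure)
open import Function.Bundles using (_↔_; Inverse)

-- A graph with  #D = suc n  vertices,
-- vertex set  Fin (suc n);  ch v  is the multiset child(v), given as a
-- list (its order is irrelevant: everything below is invariant under _↭_,
-- and isomorphism is defined up to _↭_).

record Graph : Set where
  constructor graph
  field
    n  : ℕ
    ch : Fin (suc n) → List (Fin (suc n))
open Graph public

#_ : Graph → ℕ
# G = suc (n G)

Arc : (G : Graph) → Fin (suc (n G)) → Fin (suc (n G)) → Set
Arc G u v = v ∈ ch G u

Acyclic : Graph → Set
Acyclic G = ∀ v → ¬ TransClosure (Arc G) v v

Connected : Graph → Set
Connected G = ∀ u v → EqClosure (Arc G) u v

DistinctChildren : Graph → Set
DistinctChildren G = ∀ u v → ch G u ↭ ch G v → u ≡ v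

IsFDAG : Graph → Set
IsFDAG G = Acyclic G × Connected G × DistinctChildren G

record FDAG : Set where
  constructor fdag
  field
    gr     : Graph
    isFDAG : IsFDAG gr
open FDAG public

Iso : Graph → Graph → Set
Iso G H = Σ (Fin (suc (n G)) ↔ Fin (suc (n H))) λ f →
  ∀ v → map (Inverse.to f) (ch G v) ↭ ch H (Inverse.to f v)

-- For an acyclic graph with #D vertices, h(v) ≤ #D - 1, so fuel #D
-- computes h exactly.

maxList : List ℕ → ℕ
maxList = foldr _⊔_ 0

hgtF : ∀ {m} → (Fin m → List (Fin m)) → ℕ → Fin m → ℕ
hgtF c zero    v = 0
hgtF c (suc f) v with c v
... | []      = 0
... | (u ∷ us) = suc (maxList (map (hgtF c f) (u ∷ us)))

h : (G : Graph) → Fin (suc (n G)) → ℕ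
h G v = hgtF (ch G) (# G) v

insertD : ℕ → List ℕ → List ℕ
insertD x []       = x ∷ []
insertD x (y ∷ ys) = if y ≤ᵇ x then x ∷ y ∷ ys else y ∷ insertD x ys

sortD : List ℕ → List ℕ
sortD = foldr insertD []

data _<lex_ : List ℕ → List ℕ → Set where
  []<∷  : ∀ {y ys} → [] <lex (y ∷ ys)
  head< : ∀ {x y xs ys} → x <ℕ y → (x ∷ xs) <lex (y ∷ ys)
  tail< : ∀ {x y xs ys} → x ≡ y → xs <lex ys → (x ∷ xs) <lex (y ∷ ys)

data Decreasing : List ℕ → Set where
  dec[] : Decreasing []
  dec[x] : ∀ {x} → Decreasing (x ∷ [])
  dec∷  : ∀ {x y ys} → y ≤ x → Decreasing (y ∷ ys) → Decreasing (x ∷ y ∷ ys)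

-- SC: remove the last letter (SC [] = [] is a harmless convention, it is
-- only applied to nonempty words)
SC : ∀ {A : Set} → List A → List A
SC []           = []
SC (x ∷ [])     = []
SC (x ∷ y ∷ ys) = x ∷ SC (y ∷ ys)

LastGe : List ℕ → ℕ → Set
LastGe []           a = ⊤
LastGe (x ∷ [])     a = a ≤ x
LastGe (x ∷ y ∷ ys) a = LastGe (y ∷ ys) a

module _ (G : Graph) (ψ : Fin (suc (n G)) ↔ Fin (suc (n G))) where

  ψ→ : Fin (suc (n G)) → Fin (suc (n G))
  ψ→ = Inverse.to ψ

  ψ← : Fin (suc (n G)) → Fin (suc (n G))
  ψ← = Inverse.from ψ

  childψ : Fin (suc (n G)) → List ℕ
  childψ v = sortD (map (λ w → toℕ (ψ→ w)) (ch G v))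

  IsCanonical : Set
  IsCanonical =
      (∀ u v → Arc G u v → ψ→ v < ψ→ u)
    × (∀ u v → h G v <ℕ h G u → ψ→ v < ψ→ u)
    × (∀ u v → h G u ≡ h G v → childψ v <lex childψ u → ψ→ v < ψ→ u)

  top : Fin (suc (n G))
  top = ψ← (fromℕ (n G))

  hTop : ℕ
  hTop = h G top

  -- a ∈ A_=  and  a ∈ A_<   (letters a are values of ψ)
  InA= : Fin (suc (n G)) → Set
  InA= a = h G (ψ← a) ≡ hTop

  InA< : Fin (suc (n G)) → Set
  InA< a = h G (ψ← a) <ℕ hTop

  InW : List (Fin (suc (n G))) → Set
  InW w = Decreasing (map toℕ w) × All InA< w × (childψ top <lex map toℕ w)

  MinimalW : List (Fin (suc (n G))) → Set
  MinimalW w = InW w × ¬ InW (SC w)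

  branchGraph : Fin (suc (n G)) → Graph
  branchGraph a = graph (n G) c
    where
    c : Fin (suc (n G)) → List (Fin (suc (n G)))
    c v with v ≟ top
    ... | yes _ = ψ← a ∷ ch G v
    ... | no  _ = ch G v

  -- add a new vertex (represented by  zero;  old vertex v becomes  suc v)
  -- whose children are the given vertices
  newVertexGraph : List (Fin (suc (n G))) → Graph
  newVertexGraph ws = graph (suc (n G)) c
    where
    c : Fin (suc (suc (n G))) → List (Fin (suc (suc (n G))))
    c zero    = map suc ws
    c (suc v) = map suc (ch G v)

  data Rule : Graph → Set where
    branching  : ∀ a → InA< a → LastGe (childψ top) (toℕ a) → Rule (branchGraph a)
    elongation : ∀ a → InA= a → Rule (newVertexGraph (ψ← a ∷ []))
    widening   : ∀ w → MinimalW w → Rule (newVertexGraph (map ψ← w))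

Succ : FDAG → FDAG → Set
Succ D E = Σ (Fin (suc (n (gr D))) ↔ Fin (suc (n (gr D)))) λ ψ →
  IsCanonical (gr D) ψ × Σ Graph λ G′ → Rule (gr D) ψ G′ × Iso G′ (gr E)

data Pairwise≇ : List FDAG → Set where
  []  : Pairwise≇ []
  _∷_ : ∀ {E Es} → All (λ E′ → ¬ Iso (gr E) (gr E′)) Es → Pairwise≇ Es → Pairwise≇ (E ∷ Es)

open import Data.List using (length) public

NumSucc : FDAG → ℕ → Set
NumSucc D N = Σ (List FDAG) λ L →
  length L ≡ N × All (Succ D) L × Pairwise≇ L ×
  (∀ E → Succ D E → Any (λ E′ → Iso (gr E) (gr E′)) L)

-- Work with the canonical ordering ψ of D. It exists: rank the vertices by height and then by
-- the sorted ranks of their children, refining the ranks height by height. It is unique: two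
-- canonical orderings give the same vertex each label, by induction on the label. Every label b
-- yields exactly one successor with a new vertex: the elongation to b when h(b) = h(vₙ), and
-- otherwise the widening by the only minimal word ending with b, namely the letters ≥ b of
-- child_ψ(vₙ) followed by b. Branching yields at most one successor per label. No two of these
-- are isomorphic, since an isomorphism between two one-step expansions of D fixes every vertex
-- of D (its vertices have distinct children), hence identifies the added data. So #D ≤ N ≤ 2·#D.

module Submission where

open import Defs
open import Data.Bool using (true; false; T)
open import Data.Empty using (⊥-elim)
open import Data.Fin using (Fin; zero; suc; toℕ; fromℕ; fromℕ<; punchOut) renaming (_<_ to _<ᶠ_)
open import Data.Fin.Induction using (<-wellFounded)
open import Data.Fin.Properties
  using (any?; toℕ-injective; toℕ-fromℕ<; toℕ<n; ≤fromℕ; punchOut-injective; injective⇒≤; pigeonhole; cantor-schröder-bernstein)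
  renaming (_≟_ to _≟ᶠ_)
import Data.Fin.Properties as Finₚ
open import Data.List using (List; []; _∷_; [_]; map; _++_; _∷ʳ_; length; filter; allFin; takeWhile; dropWhile)
open import Data.List.Properties
  using (map-injective; takeWhile++dropWhile; ∷ʳ-injectiveʳ; map-cong-local; filter-notAll; length-tabulate; map-cong; map-∘; map-id; length-map; length-++; ∷-injectiveˡ; ∷-injectiveʳ)
open import Data.List.Membership.Propositional using (_∈_)
open import Data.List.Membership.Propositional.Properties using (∈-map⁺; ∈-map⁻; ∈-++⁺ˡ; ∈-++⁺ʳ; ∈-++⁻; ∈-allFin)
open import Data.List.Relation.Binary.Equality.Propositional using (≋⇒≡)
open import Data.List.Relation.Binary.Permutation.Propositional
  using (_↭_; ↭-refl; ↭-prep; ↭-swap; ↭-sym; ↭-trans; ↭-reflexive; ↭⇒↭ₛ; module PermutationReasoning)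
open import Data.List.Relation.Binary.Permutation.Propositional.Properties
  using (All-resp-↭; ∈-resp-↭; ↭-map-inv; ↭-singleton-inv; drop-mid; map⁺; ∷↭∷ʳ)
open import Data.List.Relation.Unary.All using (All; []; _∷_)
import Data.List.Relation.Unary.All as All
import Data.List.Relation.Unary.All.Properties as Allₚ
open import Data.List.Relation.Unary.AllPairs using (AllPairs; []; _∷_)
import Data.List.Relation.Unary.AllPairs as AllPairs
import Data.List.Relation.Unary.AllPairs.Properties as AllPairsₚ
open import Data.List.Relation.Unary.Any using (Any; here; there)
import Data.List.Relation.Unary.Any as Any
import Data.List.Relation.Unary.Any.Properties as Anyₚ
open import Data.List.Relation.Unary.Linked using (Linked; []; [-]; _∷_)
open import Data.List.Relation.Unary.Sorted.TotalOrder.Properties using (↗↭↗⇒≋)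
open import Data.List.Relation.Unary.Unique.Propositional.Properties using (allFin⁺)
open import Data.Nat using (ℕ; zero; suc; _+_; _*_; _⊔_; _≤_; _<_; _≤ᵇ_; z≤n; s≤s; _≟_; _≤?_; _<?_)
open import Data.Nat.DivMod using (_mod_; m<n⇒m%n≡m)
open import Data.Nat.Properties
open import Data.Product using (Σ; _×_; _,_; proj₁; proj₂)
open import Data.Product.Relation.Binary.Lex.Strict using (×-Lex; ×-isStrictTotalOrder)
open import Data.Product.Relation.Binary.Pointwise.NonDependent using (Pointwise)
open import Data.Sum using (_⊎_; inj₁; inj₂)
open import Data.Unit using (tt)
open import Function using (_∘_; id; case_of_)
open import Function.Bundles using (_↔_; Inverse; Injection; mk↔ₛ′)
open import Function.Definitions using (Injective)
open import Function.Properties.Inverse using (↔-refl; ↔-sym; ↔-trans; ↔⇒↣)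
import Induction.WellFounded as WF
open import Level using (0ℓ)
open import Relation.Binary.Construct.Closure.Equivalence using (EqClosure; gmap; return)
import Relation.Binary.Construct.Closure.Equivalence as EqClosure
open import Relation.Binary.Construct.Closure.Transitive using (TransClosure; _∷_) renaming ([_] to [_]⁺)
open import Relation.Binary.Definitions using (Transitive; Trichotomous; tri<; tri≈; tri>)
open import Relation.Binary.PropositionalEquality hiding ([_])
import Relation.Binary.Properties.TotalOrder as TotalOrderProperties
open import Relation.Binary.Structures using (IsEquivalence; IsStrictTotalOrder)
open import Relation.Nullary using (¬_; Dec; yes; no; _×-dec_)
open import Relation.Unary using (Pred; Decidable; _⊆_)

module _ {A B : Set} (f : A → B) where

  map-injectiveOn : ∀ {P : A → Set} → (∀ {x y} → P x → P y → f x ≡ f y → x ≡ y) →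
                    ∀ {xs ys} → All P xs → All P ys → map f xs ≡ map f ys → xs ≡ ys
  map-injectiveOn inj [] [] _ = refl
  map-injectiveOn inj (px ∷ pxs) (py ∷ pys) e =
    cong₂ _∷_ (inj px py (∷-injectiveˡ e)) (map-injectiveOn inj pxs pys (∷-injectiveʳ e))

  ↭-map-injectiveOn⁻ : ∀ {P : A → Set} → (∀ {x y} → P x → P y → f x ≡ f y → x ≡ y) →
                       ∀ {xs ys} → All P xs → All P ys → map f xs ↭ map f ys → xs ↭ ys
  ↭-map-injectiveOn⁻ inj pxs pys p with ys′ , e , xs↭ys′ ← ↭-map-inv f p =
    subst (_ ↭_) (sym (map-injectiveOn inj pys (All-resp-↭ xs↭ys′ pxs) e)) xs↭ys′

  ↭-map-injective⁻ : Injective _≡_ _≡_ f → ∀ {xs ys} → map f xs ↭ map f ys → xs ↭ ys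
  ↭-map-injective⁻ inj p with ys′ , e , xs↭ys′ ← ↭-map-inv f p =
    subst (_ ↭_) (sym (map-injective inj e)) xs↭ys′

∷-↭-cancelʳ : ∀ {A : Set} {x y : A} zs → x ∷ zs ↭ y ∷ zs → x ≡ y
∷-↭-cancelʳ [] p with refl ← ↭-singleton-inv p = refl
∷-↭-cancelʳ {x = x} {y} (z ∷ zs) p = ∷-↭-cancelʳ zs (drop-mid [ x ] [ y ] p)

module _ {A : Set} {P : A → Set} (P? : Decidable P) {x : A} {xs : List A} where

  takeWhile-accept : P x → takeWhile P? (x ∷ xs) ≡ x ∷ takeWhile P? xs
  takeWhile-accept px with P? x
  ... | yes _ = refl
  ... | no ¬px = ⊥-elim (¬px px)

  takeWhile-reject : ¬ P x → takeWhile P? (x ∷ xs) ≡ []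
  takeWhile-reject ¬px with P? x
  ... | yes px = ⊥-elim (¬px px)
  ... | no _ = refl

takeWhile-⊆ : ∀ {A : Set} {P : A → Set} (P? : Decidable P) xs {x} → x ∈ takeWhile P? xs → x ∈ xs
takeWhile-⊆ P? xs x∈ = subst (_ ∈_) (takeWhile++dropWhile P? xs) (∈-++⁺ˡ x∈)

SC-∷ʳ : ∀ {A : Set} (xs : List A) y → SC (xs ∷ʳ y) ≡ xs
SC-∷ʳ [] y = refl
SC-∷ʳ (x ∷ []) y = refl
SC-∷ʳ (x ∷ x′ ∷ xs) y = cong (x ∷_) (SC-∷ʳ (x′ ∷ xs) y)

SC-map : ∀ {A B : Set} (f : A → B) xs → SC (map f xs) ≡ map f (SC xs)
SC-map f [] = refl
SC-map f (x ∷ []) = refl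
SC-map f (x ∷ x′ ∷ xs) = cong (f x ∷_) (SC-map f (x′ ∷ xs))

All-SC : ∀ {A : Set} {P : A → Set} {xs} → All P xs → All P (SC xs)
All-SC [] = []
All-SC (_ ∷ []) = []
All-SC (px ∷ px′ ∷ pxs) = px ∷ All-SC (px′ ∷ pxs)

∈⇒nonempty : ∀ {A : Set} {x : A} {xs} → x ∈ xs → Σ A λ u → Σ (List A) λ us → xs ≡ u ∷ us
∈⇒nonempty {xs = u ∷ us} _ = u , us , refl

maxList-≥ : ∀ {A : Set} (g : A → ℕ) {y ys} → y ∈ ys → g y ≤ maxList (map g ys)
maxList-≥ g {ys = x ∷ xs} (here refl) = m≤m⊔n (g x) (maxList (map g xs))
maxList-≥ g {ys = x ∷ xs} (there p) = ≤-trans (maxList-≥ g p) (m≤n⊔m (g x) (maxList (map g xs)))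

maxList-attained : ∀ {A : Set} (g : A → ℕ) y ys →
                   Σ A λ z → z ∈ y ∷ ys × maxList (map g (y ∷ ys)) ≡ g z
maxList-attained g y [] = y , here refl , ⊔-identityʳ (g y)
maxList-attained g y (y′ ∷ ys) with z , z∈ , e ← maxList-attained g y′ ys
                               with ⊔-sel (g y) (maxList (map g (y′ ∷ ys)))
... | inj₁ e₁ = y , here refl , e₁
... | inj₂ e₂ = z , there z∈ , trans e₂ e

module _ {A : Set} {P Q : Pred A 0ℓ} (P? : Decidable P) (Q? : Decidable Q) where

  length-filter-⊆ : P ⊆ Q → ∀ xs → length (filter P? xs) ≤ length (filter Q? xs)
  length-filter-⊆ P⊆Q [] = z≤n
  length-filter-⊆ P⊆Q (x ∷ xs) with P? x | Q? x
  ... | yes _ | yes _ = s≤s (length-filter-⊆ P⊆Q xs)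
  ... | yes px | no ¬qx = ⊥-elim (¬qx (P⊆Q px))
  ... | no _ | yes _ = m≤n⇒m≤1+n (length-filter-⊆ P⊆Q xs)
  ... | no _ | no _ = length-filter-⊆ P⊆Q xs

  length-filter-⊂ : P ⊆ Q → ∀ {x} xs → x ∈ xs → Q x → ¬ P x →
                    length (filter P? xs) < length (filter Q? xs)
  length-filter-⊂ P⊆Q (y ∷ xs) (here refl) qy ¬py with P? y | Q? y
  ... | yes py | _ = ⊥-elim (¬py py)
  ... | no _ | yes _ = s≤s (length-filter-⊆ P⊆Q xs)
  ... | no _ | no ¬qy = ⊥-elim (¬qy qy)
  length-filter-⊂ P⊆Q (y ∷ xs) (there x∈) qx ¬px with P? y | Q? y
  ... | yes _ | yes _ = s≤s (length-filter-⊂ P⊆Q xs x∈ qx ¬px)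
  ... | yes py | no ¬qy = ⊥-elim (¬qy (P⊆Q py))
  ... | no _ | yes _ = m≤n⇒m≤1+n (length-filter-⊂ P⊆Q xs x∈ qx ¬px)
  ... | no _ | no _ = length-filter-⊂ P⊆Q xs x∈ qx ¬px

length-filter-⇔ : ∀ {A : Set} {P Q : Pred A 0ℓ} (P? : Decidable P) (Q? : Decidable Q) →
                  P ⊆ Q → Q ⊆ P → ∀ xs → length (filter P? xs) ≡ length (filter Q? xs)
length-filter-⇔ P? Q? P⊆Q Q⊆P xs = ≤-antisym (length-filter-⊆ P? Q? P⊆Q xs) (length-filter-⊆ Q? P? Q⊆P xs)

module _ {A : Set} {P : A → Set} (P? : Decidable P) where

  select : List A → List (Σ A P)
  select [] = []
  select (x ∷ xs) with P? x
  ... | yes px = (x , px) ∷ select xs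
  ... | no _ = select xs

  length-select : ∀ xs → length (select xs) ≤ length xs
  length-select [] = z≤n
  length-select (x ∷ xs) with P? x
  ... | yes _ = s≤s (length-select xs)
  ... | no _ = m≤n⇒m≤1+n (length-select xs)

  ∈-select⁺ : ∀ {x xs} → x ∈ xs → P x → Σ (P x) λ px → (x , px) ∈ select xs
  ∈-select⁺ {xs = y ∷ xs} (here refl) px with P? y
  ... | yes py = py , here refl
  ... | no ¬py = ⊥-elim (¬py px)
  ∈-select⁺ {xs = y ∷ xs} (there x∈) px with P? y | ∈-select⁺ x∈ px
  ... | yes _ | px′ , x∈′ = px′ , there x∈′
  ... | no _ | x∈′ = x∈′

  All-select : ∀ {Q : A → Set} {xs} → All Q xs → All (λ p → Q (proj₁ p)) (select xs)
  All-select {xs = []} [] = []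
  All-select {xs = x ∷ xs} (qx ∷ qxs) with P? x
  ... | yes _ = qx ∷ All-select qxs
  ... | no _ = All-select qxs

  AllPairs-select : ∀ {R : A → A → Set} {xs} → AllPairs R xs → AllPairs (λ p q → R (proj₁ p) (proj₁ q)) (select xs)
  AllPairs-select {xs = []} [] = []
  AllPairs-select {xs = x ∷ xs} (Rx ∷ Rxs) with P? x
  ... | yes _ = All-select Rx ∷ AllPairs-select Rxs
  ... | no _ = AllPairs-select Rxs

module _ {A B : Set} (f : A ↔ B) where

  ↔-to-injective : Injective _≡_ _≡_ (Inverse.to f)
  ↔-to-injective = Injection.injective (↔⇒↣ f)

  ↔-from-injective : Injective _≡_ _≡_ (Inverse.from f)
  ↔-from-injective = Injection.injective (↔⇒↣ (↔-sym f))

module _ {m : ℕ} {f : Fin (suc m) → Fin (suc m)} (inj : Injective _≡_ _≡_ f) where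

  -- Otherwise punching the missed value out of f would inject Fin (1 + m) into Fin m.
  injective⇒preimage : ∀ i → Σ (Fin (suc m)) λ v → f v ≡ i
  injective⇒preimage i with any? (λ v → f v ≟ᶠ i)
  ... | yes p = p
  ... | no ¬p = ⊥-elim (<-irrefl refl (injective⇒≤ punched-injective))
    where
    f≢i : ∀ v → i ≢ f v
    f≢i v e = ¬p (v , sym e)
    punched-injective : Injective _≡_ _≡_ (λ v → punchOut (f≢i v))
    punched-injective e = inj (punchOut-injective (f≢i _) (f≢i _) e)

  injective⇒↔ : Fin (suc m) ↔ Fin (suc m)
  injective⇒↔ = mk↔ₛ′ f (λ i → proj₁ (injective⇒preimage i)) (λ i → proj₂ (injective⇒preimage i))
                       (λ v → inj (proj₂ (injective⇒preimage (f v))))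

<lex-irrefl : ∀ {xs} → ¬ xs <lex xs
<lex-irrefl (head< x<x) = <-irrefl refl x<x
<lex-irrefl (tail< _ p) = <lex-irrefl p

<lex-trans : Transitive _<lex_
<lex-trans []<∷ (head< _) = []<∷
<lex-trans []<∷ (tail< _ _) = []<∷
<lex-trans (head< p) (head< q) = head< (<-trans p q)
<lex-trans (head< p) (tail< refl _) = head< p
<lex-trans (tail< refl _) (head< q) = head< q
<lex-trans (tail< refl p) (tail< refl q) = tail< refl (<lex-trans p q)

<lex-asym : ∀ {xs ys} → xs <lex ys → ¬ ys <lex xs
<lex-asym p q = <lex-irrefl (<lex-trans p q)

<lex-cmp : Trichotomous _≡_ _<lex_
<lex-cmp [] [] = tri≈ <lex-irrefl refl <lex-irrefl
<lex-cmp [] (y ∷ ys) = tri< []<∷ (λ ()) (λ ())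
<lex-cmp (x ∷ xs) [] = tri> (λ ()) (λ ()) []<∷
<lex-cmp (x ∷ xs) (y ∷ ys) with <-cmp x y
... | tri< x<y _ _ = tri< (head< x<y) (λ { refl → <-irrefl refl x<y }) (<lex-asym (head< x<y))
... | tri> _ _ y<x = tri> (<lex-asym (head< y<x)) (λ { refl → <-irrefl refl y<x }) (head< y<x)
... | tri≈ _ refl _ with <lex-cmp xs ys
...   | tri< p _ _ = tri< (tail< refl p) (λ { refl → <lex-irrefl p }) (<lex-asym (tail< refl p))
...   | tri≈ _ refl _ = tri≈ <lex-irrefl refl <lex-irrefl
...   | tri> _ _ p = tri> (<lex-asym (tail< refl p)) (λ { refl → <lex-irrefl p }) (tail< refl p)

<lex-isStrictTotalOrder : IsStrictTotalOrder _≡_ _<lex_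
<lex-isStrictTotalOrder = record
  { isStrictPartialOrder = record
    { isEquivalence = isEquivalence
    ; irrefl = λ { refl → <lex-irrefl }
    ; trans = <lex-trans
    ; <-resp-≈ = (λ { refl p → p }) , (λ { refl p → p })
    }
  ; compare = <lex-cmp
  }

prefix-<lex : ∀ xs {y ys} → xs <lex (xs ++ y ∷ ys)
prefix-<lex [] = []<∷
prefix-<lex (x ∷ xs) = tail< refl (prefix-<lex xs)

extension-≮lex : ∀ xs ys → ¬ (xs ++ ys) <lex xs
extension-≮lex (x ∷ xs) ys (head< x<x) = <-irrefl refl x<x
extension-≮lex (x ∷ xs) ys (tail< _ p) = extension-≮lex xs ys p

Decreasing-tail : ∀ {x xs} → Decreasing (x ∷ xs) → Decreasing xs
Decreasing-tail dec[x] = dec[]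
Decreasing-tail (dec∷ _ d) = d

Decreasing-head : ∀ {x xs} → Decreasing (x ∷ xs) → All (_≤ x) xs
Decreasing-head dec[x] = []
Decreasing-head (dec∷ y≤x d) = y≤x ∷ All.map (λ z≤y → ≤-trans z≤y y≤x) (Decreasing-head d)

Decreasing-∷ : ∀ {x xs} → All (_≤ x) xs → Decreasing xs → Decreasing (x ∷ xs)
Decreasing-∷ [] _ = dec[x]
Decreasing-∷ (y≤x ∷ _) d = dec∷ y≤x d

Decreasing-∷ʳ : ∀ {xs a} → Decreasing xs → LastGe xs a → Decreasing (xs ∷ʳ a)
Decreasing-∷ʳ {[]} _ _ = dec[x]
Decreasing-∷ʳ {x ∷ []} _ a≤x = dec∷ a≤x dec[x]
Decreasing-∷ʳ {x ∷ y ∷ ys} (dec∷ y≤x d) l = dec∷ y≤x (Decreasing-∷ʳ d l)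

Decreasing-SC : ∀ {xs} → Decreasing xs → Decreasing (SC xs)
Decreasing-SC {[]} _ = dec[]
Decreasing-SC {x ∷ []} _ = dec[]
Decreasing-SC {x ∷ y ∷ []} _ = dec[x]
Decreasing-SC {x ∷ y ∷ z ∷ zs} (dec∷ y≤x d) = dec∷ y≤x (Decreasing-SC d)

∈-Decreasing-≤-head : ∀ {x xs y} → Decreasing (x ∷ xs) → y ∈ x ∷ xs → y ≤ x
∈-Decreasing-≤-head d (here refl) = ≤-refl
∈-Decreasing-≤-head d (there y∈) = All.lookup (Decreasing-head d) y∈

open TotalOrderProperties ≤-totalOrder using (≥-totalOrder)

Decreasing⇒Sorted : ∀ {xs} → Decreasing xs → Linked (λ x y → y ≤ x) xs
Decreasing⇒Sorted dec[] = []
Decreasing⇒Sorted dec[x] = [-]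
Decreasing⇒Sorted (dec∷ y≤x d) = y≤x ∷ Decreasing⇒Sorted d

Decreasing-↭⇒≡ : ∀ {xs ys} → Decreasing xs → Decreasing ys → xs ↭ ys → xs ≡ ys
Decreasing-↭⇒≡ dxs dys p =
  ≋⇒≡ (↗↭↗⇒≋ ≥-totalOrder (Decreasing⇒Sorted dxs) (Decreasing⇒Sorted dys) (↭⇒↭ₛ p))

insertD-↭ : ∀ x ys → insertD x ys ↭ x ∷ ys
insertD-↭ x [] = ↭-refl
insertD-↭ x (y ∷ ys) with y ≤ᵇ x
... | true = ↭-refl
... | false = ↭-trans (↭-prep y (insertD-↭ x ys)) (↭-swap y x ↭-refl)

sortD-↭ : ∀ xs → sortD xs ↭ xs
sortD-↭ [] = ↭-refl
sortD-↭ (x ∷ xs) = ↭-trans (insertD-↭ x (sortD xs)) (↭-prep x (sortD-↭ xs))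

insertD-Decreasing : ∀ x {ys} → Decreasing ys → Decreasing (insertD x ys)
insertD-Decreasing x {[]} d = dec[x]
insertD-Decreasing x {y ∷ ys} d with y ≤ᵇ x in y≤ᵇx
... | true = dec∷ (≤ᵇ⇒≤ y x (subst T (sym y≤ᵇx) tt)) d
... | false = Decreasing-∷ (All-resp-↭ (↭-sym (insertD-↭ x ys)) (x≤y ∷ Decreasing-head d))
                           (insertD-Decreasing x (Decreasing-tail d))
  where
  x≤y : x ≤ y
  x≤y = ≰⇒≥ (λ y≤x → subst T y≤ᵇx (≤⇒≤ᵇ y≤x))

sortD-Decreasing : ∀ xs → Decreasing (sortD xs)
sortD-Decreasing [] = dec[]
sortD-Decreasing (x ∷ xs) = insertD-Decreasing x (sortD-Decreasing xs)

sortD-↭-cong : ∀ {xs ys} → xs ↭ ys → sortD xs ≡ sortD ys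
sortD-↭-cong {xs} {ys} p = Decreasing-↭⇒≡ (sortD-Decreasing xs) (sortD-Decreasing ys)
  (↭-trans (sortD-↭ xs) (↭-trans p (↭-sym (sortD-↭ ys))))

sortD-Decreasing-id : ∀ {xs} → Decreasing xs → sortD xs ≡ xs
sortD-Decreasing-id {xs} d = Decreasing-↭⇒≡ (sortD-Decreasing xs) d (sortD-↭ xs)

<lex⇒nonempty : ∀ {xs ys} → xs <lex ys → Σ ℕ λ y → Σ (List ℕ) λ ys′ → ys ≡ y ∷ ys′
<lex⇒nonempty {ys = y ∷ ys′} _ = y , ys′ , refl

<lex-head-≤ : ∀ {x xs y ys} → (x ∷ xs) <lex (y ∷ ys) → x ≤ y
<lex-head-≤ (head< x<y) = <⇒≤ x<y
<lex-head-≤ (tail< refl _) = ≤-refl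

-- The only candidate for a minimal word above c with last letter k.
minimalAbove : ℕ → List ℕ → List ℕ
minimalAbove k c = takeWhile (k ≤?_) c ∷ʳ k

minimalAbove-Decreasing : ∀ k {c} → Decreasing c → Decreasing (minimalAbove k c)
minimalAbove-Decreasing k {[]} d = dec[x]
minimalAbove-Decreasing k {x ∷ xs} d with k ≤? x
... | no k≰x = subst (λ t → Decreasing (t ∷ʳ k)) (sym (takeWhile-reject (k ≤?_) k≰x)) dec[x]
... | yes k≤x = subst (λ t → Decreasing (t ∷ʳ k)) (sym (takeWhile-accept (k ≤?_) k≤x))
                  (Decreasing-∷ (All.tabulate below-x) (minimalAbove-Decreasing k (Decreasing-tail d)))
  where
  below-x : ∀ {ℓ} → ℓ ∈ minimalAbove k xs → ℓ ≤ x
  below-x ℓ∈ with ∈-++⁻ (takeWhile (k ≤?_) xs) ℓ∈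
  ... | inj₁ ℓ∈′ = All.lookup (Decreasing-head d) (takeWhile-⊆ (k ≤?_) xs ℓ∈′)
  ... | inj₂ (here refl) = k≤x

<lex-minimalAbove : ∀ k c → c <lex minimalAbove k c
<lex-minimalAbove k [] = []<∷
<lex-minimalAbove k (x ∷ xs) with k ≤? x
... | yes k≤x = subst (λ t → (x ∷ xs) <lex (t ∷ʳ k)) (sym (takeWhile-accept (k ≤?_) k≤x))
                  (tail< refl (<lex-minimalAbove k xs))
... | no k≰x = subst (λ t → (x ∷ xs) <lex (t ∷ʳ k)) (sym (takeWhile-reject (k ≤?_) k≰x)) (head< (≰⇒> k≰x))

≮lex-SC-minimalAbove : ∀ k c → ¬ c <lex SC (minimalAbove k c)
≮lex-SC-minimalAbove k c c< = extension-≮lex (takeWhile (k ≤?_) c) (dropWhile (k ≤?_) c)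
  (subst₂ _<lex_ (sym (takeWhile++dropWhile (k ≤?_) c)) (SC-∷ʳ _ k) c<)

∈-minimalAbove-last : ∀ k c → k ∈ minimalAbove k c
∈-minimalAbove-last k c = ∈-++⁺ʳ (takeWhile (k ≤?_) c) (here refl)

minimalAbove-injective : ∀ {k k′} c → minimalAbove k c ≡ minimalAbove k′ c → k ≡ k′
minimalAbove-injective c = ∷ʳ-injectiveʳ (takeWhile (_ ≤?_) c) (takeWhile (_ ≤?_) c)

minimal⇒minimalAbove : ∀ c w → Decreasing w → c <lex w → ¬ c <lex SC w → Σ ℕ λ k → w ≡ minimalAbove k c
minimal⇒minimalAbove [] (x ∷ []) _ _ _ = x , refl
minimal⇒minimalAbove (c₀ ∷ cs) (x ∷ []) _ (head< c₀<x) _ =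
  x , cong (_∷ʳ x) (sym (takeWhile-reject (x ≤?_) (<⇒≱ c₀<x)))
minimal⇒minimalAbove [] (x ∷ y ∷ ys) _ _ c≮ = ⊥-elim (c≮ []<∷)
minimal⇒minimalAbove (c₀ ∷ cs) (x ∷ y ∷ ys) _ (head< c₀<x) c≮ = ⊥-elim (c≮ (head< c₀<x))
minimal⇒minimalAbove (x ∷ cs) (x ∷ y ∷ ys) d (tail< refl cs<) c≮
  with k , e ← minimal⇒minimalAbove cs (y ∷ ys) (Decreasing-tail d) cs< (c≮ ∘ tail< refl)
  = k , trans (cong (x ∷_) e) (cong (_∷ʳ k) (sym (takeWhile-accept (k ≤?_) k≤x)))
  where
  k≤x : k ≤ x
  k≤x = ∈-Decreasing-≤-head d (there (subst (k ∈_) (sym e) (∈-minimalAbove-last k cs)))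

lastGe? : ∀ xs a → Dec (LastGe xs a)
lastGe? [] a = yes tt
lastGe? (x ∷ []) a = a ≤? x
lastGe? (x ∷ y ∷ ys) a = lastGe? (y ∷ ys) a

-- Heights

module Height (G : Graph) (acyclic : Acyclic G) where

  V : Set
  V = Fin (# G)

  data Walk : ℕ → V → Set where
    stop : ∀ {v} → Walk 0 v
    step : ∀ {k v w} → Arc G v w → Walk k w → Walk (suc k) v

  vertex : ∀ {k v} → Walk k v → Fin (suc k) → V
  vertex {v = v} _ zero = v
  vertex (step _ p) (suc i) = vertex p i

  vertex-reachable : ∀ {k v} (p : Walk k v) j → TransClosure (Arc G) v (vertex p (suc j))
  vertex-reachable (step a p) zero = [ a ]⁺
  vertex-reachable (step a p) (suc j) = a ∷ vertex-reachable p j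

  vertex-<-reachable : ∀ {k v} (p : Walk k v) i j → toℕ i < toℕ j →
                       TransClosure (Arc G) (vertex p i) (vertex p j)
  vertex-<-reachable p zero (suc j) _ = vertex-reachable p j
  vertex-<-reachable (step a p) (suc i) (suc j) (s≤s i<j) = vertex-<-reachable p i j i<j

  -- By pigeonhole such a walk repeats a vertex, closing a cycle.
  ¬long-Walk : ∀ {k v} → n G < k → ¬ Walk k v
  ¬long-Walk n<k p with i , j , i<j , e ← pigeonhole (s≤s n<k) (vertex p) =
    acyclic (vertex p j) (subst (λ z → TransClosure (Arc G) z (vertex p j)) e (vertex-<-reachable p i j i<j))

  hgtF-≤-fuel : ∀ f v → hgtF (ch G) f v ≤ f
  hgtF-≤-fuel zero v = z≤n
  hgtF-≤-fuel (suc f) v with ch G v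
  ... | [] = z≤n
  ... | u ∷ us with z , _ , e ← maxList-attained (hgtF (ch G) f) u us =
    s≤s (subst (_≤ f) (sym e) (hgtF-≤-fuel f z))

  hgtF≡fuel⇒Walk : ∀ f v → hgtF (ch G) f v ≡ f → Walk f v
  hgtF≡fuel⇒Walk zero v e = stop
  hgtF≡fuel⇒Walk (suc f) v e with ch G v in chv
  ... | u ∷ us with z , z∈ , e′ ← maxList-attained (hgtF (ch G) f) u us =
    step (subst (z ∈_) (sym chv) z∈) (hgtF≡fuel⇒Walk f z (trans (sym e′) (suc-injective e)))

  hgtF-child-< : ∀ {v x} → Arc G v x → hgtF (ch G) (n G) x < n G
  hgtF-child-< {v} {x} a with m≤n⇒m<n∨m≡n (hgtF-≤-fuel (n G) x)
  ... | inj₁ lt = lt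
  ... | inj₂ e = ⊥-elim (¬long-Walk ≤-refl (step a (hgtF≡fuel⇒Walk (n G) x e)))

  hgtF-stable : ∀ f x → hgtF (ch G) f x < f → hgtF (ch G) (suc f) x ≡ hgtF (ch G) f x
  hgtF-stable (suc f) x lt with ch G x
  ... | [] = refl
  ... | u ∷ us = cong (λ hs → suc (maxList hs)) (map-cong-local {xs = u ∷ us} (All.tabulate λ y∈ →
                   hgtF-stable f _ (≤-trans (s≤s (maxList-≥ (hgtF (ch G) f) y∈)) (≤-pred lt))))

  h-child : ∀ {v x} → Arc G v x → h G x ≡ hgtF (ch G) (n G) x
  h-child a = hgtF-stable (n G) _ (hgtF-child-< a)

  h-leaf : ∀ {v} → ch G v ≡ [] → h G v ≡ 0
  h-leaf {v} e with ch G v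
  h-leaf refl | [] = refl

  h-node : ∀ {v u us} → ch G v ≡ u ∷ us → h G v ≡ suc (maxList (map (h G) (u ∷ us)))
  h-node {v} {u} {us} e = trans (unfold e) (cong (λ hs → suc (maxList hs))
    (map-cong-local (All.tabulate λ y∈ → sym (h-child (subst (_ ∈_) (sym e) y∈)))))
    where
    unfold : ∀ {f} → ch G v ≡ u ∷ us → hgtF (ch G) (suc f) v ≡ suc (maxList (map (hgtF (ch G) f) (u ∷ us)))
    unfold e with ch G v
    unfold refl | _ = refl

  h-arc : ∀ {v x} → Arc G v x → h G x < h G v
  h-arc {v} {x} a with u , us , chv ← ∈⇒nonempty a =
    subst (h G x <_) (sym (h-node chv)) (s≤s (maxList-≥ (h G) (subst (x ∈_) chv a)))

  h-maxChild : ∀ {v u us} → ch G v ≡ u ∷ us → Σ V λ z → Arc G v z × h G v ≡ suc (h G z)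
  h-maxChild {v} {u} {us} e with z , z∈ , e′ ← maxList-attained (h G) u us =
    z , subst (z ∈_) (sym e) z∈ , trans (h-node e) (cong suc e′)

  h-≤-n : ∀ v → h G v ≤ n G
  h-≤-n v = by-children (ch G v) refl
    where
    by-children : ∀ cs → ch G v ≡ cs → h G v ≤ n G
    by-children [] chv = subst (_≤ n G) (sym (h-leaf chv)) z≤n
    by-children (u ∷ us) chv with z , a , e ← h-maxChild chv =
      subst (_≤ n G) (sym e) (subst (_< n G) (sym (h-child a)) (hgtF-child-< a))

measure⇒Acyclic : (H : Graph) (μ : Fin (# H) → ℕ) → (∀ u v → Arc H u v → μ v < μ u) → Acyclic H
measure⇒Acyclic H μ decreasing v cycle = <-irrefl refl (along cycle)
  where
  along : ∀ {x y} → TransClosure (Arc H) x y → μ y < μ x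
  along [ x→y ]⁺ = decreasing _ _ x→y
  along (x→z ∷ z→y) = <-trans (along z→y) (decreasing _ _ x→z)

-- Existence of the canonical ordering

Key : Set
Key = ℕ × List ℕ

_<ᴷ_ : Key → Key → Set
_<ᴷ_ = ×-Lex _≡_ _<_ _<lex_

<ᴷ-isStrictTotalOrder : IsStrictTotalOrder (Pointwise _≡_ _≡_) _<ᴷ_
<ᴷ-isStrictTotalOrder = ×-isStrictTotalOrder <-isStrictTotalOrder <lex-isStrictTotalOrder

module <ᴷ = IsStrictTotalOrder <ᴷ-isStrictTotalOrder

<ᴷ-irrefl : ∀ {k} → ¬ k <ᴷ k
<ᴷ-irrefl = <ᴷ.irrefl (refl , refl)

<ᴷ-≢-first : ∀ {a b s t s′ t′} → a ≢ b → (a , s) <ᴷ (b , t) → (a , s′) <ᴷ (b , t′)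
<ᴷ-≢-first a≢b (inj₁ a<b) = inj₁ a<b
<ᴷ-≢-first a≢b (inj₂ (a≡b , _)) = ⊥-elim (a≢b a≡b)

module CanonicalExistence (G : Graph) (acyclic : Acyclic G) (distinct : DistinctChildren G) where

  open Height G acyclic

  vertices : List V
  vertices = allFin (# G)

  mutual
    rank : ℕ → V → ℕ
    rank zero v = 0
    rank (suc f) v = length (filter (λ u → key f u <ᴷ.<? key f v) vertices)

    key : ℕ → V → Key
    key f v = h G v , sortD (map (rank f) (ch G v))

  rank-stable : ∀ k v → h G v < k → ∀ f → k ≤ f → rank f v ≡ rank k v
  rank-stable (suc k) v hv<k (suc f) (s≤s k≤f) =
    length-filter-⇔ (λ u → key f u <ᴷ.<? key f v) (λ u → key k u <ᴷ.<? key k v)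
      (λ {u} → proj₁ (same-order u)) (λ {u} → proj₂ (same-order u)) vertices
    where
    key-stable : ∀ u → h G u < suc k → key f u ≡ key k u
    key-stable u hu<k = cong (λ cs → h G u , sortD cs) (map-cong-local (All.tabulate λ u→y →
      rank-stable k _ (≤-trans (h-arc u→y) (≤-pred hu<k)) f k≤f))
    same-order : ∀ u → (key f u <ᴷ key f v → key k u <ᴷ key k v) × (key k u <ᴷ key k v → key f u <ᴷ key f v)
    same-order u with h G u ≟ h G v
    ... | yes hu≡hv = subst₂ _<ᴷ_ (key-stable u hu<k) (key-stable v hv<k)
                    , subst₂ _<ᴷ_ (sym (key-stable u hu<k)) (sym (key-stable v hv<k))
      where
      hu<k : h G u < suc k
      hu<k = subst (_< suc k) (sym hu≡hv) hv<k
    ... | no hu≢hv = <ᴷ-≢-first hu≢hv , <ᴷ-≢-first hu≢hv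

  finalRank : V → ℕ
  finalRank = rank (suc (n G))

  finalRank-below : ∀ {v} → h G v < n G → finalRank v ≡ rank (n G) v
  finalRank-below {v} hv = rank-stable (n G) v hv (suc (n G)) (n≤1+n (n G))

  finalRank-child : ∀ {u v} → Arc G u v → finalRank v ≡ rank (n G) v
  finalRank-child {u} u→v = finalRank-below (<-≤-trans (h-arc u→v) (h-≤-n u))

  finalRank-mono : ∀ {u v} → key (n G) u <ᴷ key (n G) v → finalRank u < finalRank v
  finalRank-mono {u} {v} u<v = length-filter-⊂ (λ w → key (n G) w <ᴷ.<? key (n G) u)
    (λ w → key (n G) w <ᴷ.<? key (n G) v) (λ w<u → <ᴷ.trans w<u u<v) vertices (∈-allFin u) u<v <ᴷ-irrefl

  finalRank-< : ∀ v → finalRank v < # G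
  finalRank-< v = subst (finalRank v <_) (length-tabulate (λ w → w))
    (filter-notAll (λ w → key (n G) w <ᴷ.<? key (n G) v) vertices (Any.map (λ { refl → <ᴷ-irrefl }) (∈-allFin v)))

  -- Equal keys give equal multisets of ranks of children; the children being lower,
  -- their ranks are injective by induction on the height.
  finalRank-injective-below : ∀ k {u v} → h G u < k → finalRank u ≡ finalRank v → u ≡ v
  finalRank-injective-below (suc k) {u} {v} hu<k ru≡rv with <ᴷ.compare (key (n G) u) (key (n G) v)
  ... | tri< u<v _ _ = ⊥-elim (<-irrefl ru≡rv (finalRank-mono u<v))
  ... | tri> _ _ v<u = ⊥-elim (<-irrefl (sym ru≡rv) (finalRank-mono v<u))
  ... | tri≈ _ (hu≡hv , cu≡cv) _ = distinct u v (↭-map-injectiveOn⁻ (rank (n G)) rank-injective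
      (All.tabulate h-arc) (All.tabulate λ v→y → subst (_ <_) (sym hu≡hv) (h-arc v→y))
      (↭-trans (↭-sym (sortD-↭ _)) (↭-trans (↭-reflexive cu≡cv) (sortD-↭ _))))
    where
    rank-injective : ∀ {x y} → h G x < h G u → h G y < h G u → rank (n G) x ≡ rank (n G) y → x ≡ y
    rank-injective {x} {y} hx hy e = finalRank-injective-below k (≤-trans hx (≤-pred hu<k))
      (trans (finalRank-below (<-≤-trans hx (h-≤-n u)))
             (trans e (sym (finalRank-below (<-≤-trans hy (h-≤-n u))))))

  position : V → V
  position v = fromℕ< (finalRank-< v)

  toℕ-position : ∀ v → toℕ (position v) ≡ finalRank v
  toℕ-position v = toℕ-fromℕ< (finalRank-< v)

  position-injective : Injective _≡_ _≡_ position
  position-injective {u} e = finalRank-injective-below (suc (n G)) (s≤s (h-≤-n u))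
    (trans (sym (toℕ-position u)) (trans (cong toℕ e) (toℕ-position _)))

  ψ₀ : V ↔ V
  ψ₀ = injective⇒↔ position-injective

  childψ₀ : ∀ v → childψ G ψ₀ v ≡ sortD (map (rank (n G)) (ch G v))
  childψ₀ v = cong sortD (map-cong-local (All.tabulate λ v→y → trans (toℕ-position _) (finalRank-child v→y)))

  position-mono : ∀ {u v} → key (n G) u <ᴷ key (n G) v → position u <ᶠ position v
  position-mono {u} {v} u<v = subst₂ _<_ (sym (toℕ-position u)) (sym (toℕ-position v)) (finalRank-mono u<v)

  ψ₀-canonical : IsCanonical G ψ₀
  ψ₀-canonical = (λ u v u→v → position-mono (inj₁ (h-arc u→v)))
               , (λ u v hv<hu → position-mono (inj₁ hv<hu))
               , (λ u v hu≡hv cv<cu → position-mono (inj₂ (sym hu≡hv , subst₂ _<lex_ (childψ₀ v) (childψ₀ u) cv<cu)))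

-- Uniqueness of the canonical ordering

module CanonicalUniqueness (G : Graph) (acyclic : Acyclic G) (distinct : DistinctChildren G)
  (ψ₁ ψ₂ : Fin (# G) ↔ Fin (# G)) (can₁ : IsCanonical G ψ₁) (can₂ : IsCanonical G ψ₂) where

  open Height G acyclic
  module ψ₁ = Inverse ψ₁
  module ψ₂ = Inverse ψ₂

  -- The vertices labelled j by ψ₁ and ψ₂ have all their children below j, where ψ₁ and ψ₂ agree;
  -- the canonical conditions then force equal heights and equal child words, so they coincide.
  same-from-step : ∀ j → (∀ {j′} → toℕ j′ < toℕ j → ψ₁.from j′ ≡ ψ₂.from j′) → ψ₁.from j ≡ ψ₂.from j
  same-from-step j IH = distinct u v (↭-map-injective⁻ label₁ label₁-injective
         (↭-trans (↭-sym (sortD-↭ _)) (↭-trans (↭-reflexive same-child-words) (sortD-↭ _))))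
    where
    u v : V
    u = ψ₁.from j
    v = ψ₂.from j
    label₁ label₂ : V → ℕ
    label₁ w = toℕ (ψ₁.to w)
    label₂ w = toℕ (ψ₂.to w)
    label₁-injective : Injective _≡_ _≡_ label₁
    label₁-injective e = ↔-to-injective ψ₁ (toℕ-injective e)
    label₁u : label₁ u ≡ toℕ j
    label₁u = cong toℕ (ψ₁.strictlyInverseˡ j)
    label₂v : label₂ v ≡ toℕ j
    label₂v = cong toℕ (ψ₂.strictlyInverseˡ j)
    agree₁ : ∀ w → label₁ w < toℕ j → ψ₁.to w ≡ ψ₂.to w
    agree₁ w lt = trans (sym (ψ₂.strictlyInverseˡ _)) (cong ψ₂.to (trans (sym (IH lt)) (ψ₁.strictlyInverseʳ w)))
    agree₂ : ∀ w → label₂ w < toℕ j → ψ₁.to w ≡ ψ₂.to w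
    agree₂ w lt = trans (cong ψ₁.to (trans (sym (ψ₂.strictlyInverseʳ w)) (sym (IH lt)))) (ψ₁.strictlyInverseˡ _)
    ¬label₁v< : ¬ label₁ v < toℕ j
    ¬label₁v< lt = <-irrefl (trans (cong toℕ (agree₁ v lt)) label₂v) lt
    ¬label₂u< : ¬ label₂ u < toℕ j
    ¬label₂u< lt = <-irrefl (trans (sym (cong toℕ (agree₂ u lt))) label₁u) lt
    same-height : h G u ≡ h G v
    same-height with <-cmp (h G u) (h G v)
    ... | tri≈ _ e _ = e
    ... | tri< hu<hv _ _ = ⊥-elim (¬label₂u< (subst (label₂ u <_) label₂v (proj₁ (proj₂ can₂) v u hu<hv)))
    ... | tri> _ _ hv<hu = ⊥-elim (¬label₁v< (subst (label₁ v <_) label₁u (proj₁ (proj₂ can₁) u v hv<hu)))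
    same-childψ : ∀ x → (∀ w → Arc G x w → ψ₁.to w ≡ ψ₂.to w) → childψ G ψ₁ x ≡ childψ G ψ₂ x
    same-childψ x agree = cong sortD (map-cong-local (All.tabulate λ x→w → cong toℕ (agree _ x→w)))
    childψu : childψ G ψ₁ u ≡ childψ G ψ₂ u
    childψu = same-childψ u λ w u→w → agree₁ w (subst (label₁ w <_) label₁u (proj₁ can₁ u w u→w))
    childψv : childψ G ψ₁ v ≡ childψ G ψ₂ v
    childψv = same-childψ v λ w v→w → agree₂ w (subst (label₂ w <_) label₂v (proj₁ can₂ v w v→w))
    same-child-words : childψ G ψ₁ u ≡ childψ G ψ₁ v
    same-child-words with <lex-cmp (childψ G ψ₁ u) (childψ G ψ₁ v)
    ... | tri≈ _ e _ = e
    ... | tri< cu<cv _ _ = ⊥-elim (¬label₂u< (subst (label₂ u <_) label₂v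
            (proj₂ (proj₂ can₂) v u (sym same-height) (subst₂ _<lex_ childψu childψv cu<cv))))
    ... | tri> _ _ cv<cu = ⊥-elim (¬label₁v< (subst (label₁ v <_) label₁u (proj₂ (proj₂ can₁) u v same-height cv<cu)))

  same-from : ∀ j → ψ₁.from j ≡ ψ₂.from j
  same-from = WF.All.wfRec <-wellFounded 0ℓ (λ j → ψ₁.from j ≡ ψ₂.from j) same-from-step

  same-to : ∀ v → ψ₁.to v ≡ ψ₂.to v
  same-to v = trans (sym (ψ₂.strictlyInverseˡ _)) (cong ψ₂.to (trans (sym (same-from _)) (ψ₁.strictlyInverseʳ v)))

Iso-reflexive : ∀ {m} {c₁ c₂ : Fin (suc m) → List (Fin (suc m))} → (∀ v → c₁ v ≡ c₂ v) → Iso (graph m c₁) (graph m c₂)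
Iso-reflexive c₁≗c₂ = ↔-refl , λ v → ↭-reflexive (trans (map-id _) (c₁≗c₂ v))

Iso-sym : ∀ {G H} → Iso G H → Iso H G
Iso-sym {G} {H} (f , f-arcs) = ↔-sym f , λ w → begin
  map from (ch H w)                 ≡⟨ cong (λ x → map from (ch H x)) (sym (strictlyInverseˡ w)) ⟩
  map from (ch H (to (from w)))     ↭⟨ ↭-sym (map⁺ from (f-arcs (from w))) ⟩
  map from (map to (ch G (from w))) ≡⟨ trans (sym (map-∘ _)) (trans (map-cong strictlyInverseʳ _) (map-id _)) ⟩
  ch G (from w)                     ∎
  where
  open Inverse f
  open PermutationReasoning

Iso-trans : ∀ {G H K} → Iso G H → Iso H K → Iso G K
Iso-trans {G} (f , f-arcs) (g , g-arcs) = ↔-trans f g , λ v →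
  ↭-trans (↭-reflexive (map-∘ (ch G v))) (↭-trans (map⁺ (Inverse.to g) (f-arcs v)) (g-arcs _))

Iso⇒#≡ : ∀ {G H} → Iso G H → # G ≡ # H
Iso⇒#≡ (f , _) = cantor-schröder-bernstein (↔-to-injective f) (↔-from-injective f)

-- An isomorphism into a graph with distinct children fixes, by induction on μ, every vertex of
-- a set closed under children on which both graphs agree.
module _ {m} {c₁ c₂ : Fin (suc m) → List (Fin (suc m))} (φ : Iso (graph m c₁) (graph m c₂))
         (distinct₂ : DistinctChildren (graph m c₂)) (Fixed : Fin (suc m) → Set) (μ : Fin (suc m) → ℕ)
         (agree : ∀ {v} → Fixed v → c₁ v ≡ c₂ v)
         (closed : ∀ {v y} → Fixed v → y ∈ c₁ v → Fixed y × μ y < μ v) where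

  open Inverse (proj₁ φ)

  Iso-fixes-below : ∀ k v → μ v < k → Fixed v → to v ≡ v
  Iso-fixes-below (suc k) v μv<k fixed = distinct₂ (to v) v (begin
    c₂ (to v)     ↭⟨ ↭-sym (proj₂ φ v) ⟩
    map to (c₁ v) ≡⟨ trans (map-cong-local children-fixed) (map-id _) ⟩
    c₁ v          ≡⟨ agree fixed ⟩
    c₂ v          ∎)
    where
    open PermutationReasoning
    children-fixed : All (λ y → to y ≡ y) (c₁ v)
    children-fixed = All.tabulate λ y∈ → let (fixed-y , μy<μv) = closed fixed y∈ in
      Iso-fixes-below k _ (≤-trans μy<μv (≤-pred μv<k)) fixed-y

  Iso-fixes : ∀ v → Fixed v → to v ≡ v
  Iso-fixes v = Iso-fixes-below (suc (μ v)) v ≤-refl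

-- The expansion rules

module Expansion (G : Graph) (acyclic : Acyclic G) (connected : Connected G) (distinct : DistinctChildren G)
  (ψ : Fin (# G) ↔ Fin (# G)) (canonical : IsCanonical G ψ) where

  open Height G acyclic public
  open Inverse ψ using (to; from; strictlyInverseˡ; strictlyInverseʳ)

  arc-label : ∀ {u v} → Arc G u v → to v <ᶠ to u
  arc-label = proj₁ canonical _ _

  height-label : ∀ {u v} → h G v < h G u → to v <ᶠ to u
  height-label = proj₁ (proj₂ canonical) _ _

  word-label : ∀ {u v} → h G u ≡ h G v → childψ G ψ v <lex childψ G ψ u → to v <ᶠ to u
  word-label = proj₂ (proj₂ canonical) _ _

  label : V → ℕ
  label v = toℕ (to v)

  label-from : ∀ a → label (from a) ≡ toℕ a
  label-from a = cong toℕ (strictlyInverseˡ a)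

  vₙ : V
  vₙ = top G ψ

  hₙ : ℕ
  hₙ = hTop G ψ

  cₙ : List ℕ
  cₙ = childψ G ψ vₙ

  cₙ-Decreasing : Decreasing cₙ
  cₙ-Decreasing = sortD-Decreasing (map label (ch G vₙ))

  ∈-childψ⁻ : ∀ {v ℓ} → ℓ ∈ childψ G ψ v → Σ V λ y → Arc G v y × ℓ ≡ label y
  ∈-childψ⁻ {v} ℓ∈ = ∈-map⁻ label (∈-resp-↭ (sortD-↭ (map label (ch G v))) ℓ∈)

  ∈-childψ⁺ : ∀ {v y} → Arc G v y → label y ∈ childψ G ψ v
  ∈-childψ⁺ {v} v→y = ∈-resp-↭ (↭-sym (sortD-↭ (map label (ch G v)))) (∈-map⁺ label v→y)

  label-≤-top : ∀ v → label v ≤ label vₙ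
  label-≤-top v = subst (label v ≤_) (sym (label-from (fromℕ (n G)))) (≤fromℕ (to v))

  label-≤⇒h-≤ : ∀ {x y} → label x ≤ label y → h G x ≤ h G y
  label-≤⇒h-≤ lx≤ly = ≮⇒≥ λ hy<hx → <⇒≱ (height-label hy<hx) lx≤ly

  h-≤-top : ∀ v → h G v ≤ hₙ
  h-≤-top v = label-≤⇒h-≤ (label-≤-top v)

  ¬arc-to-top : ∀ {u} → ¬ Arc G u vₙ
  ¬arc-to-top u→vₙ = <⇒≱ (arc-label u→vₙ) (label-≤-top _)

  ∈-cₙ-≤-head : ∀ {ℓ c cs} → ℓ ∈ cₙ → cₙ <lex (c ∷ cs) → ℓ ≤ c
  ∈-cₙ-≤-head ℓ∈ cₙ< with _ , _ , cₙ≡ ← ∈⇒nonempty ℓ∈ =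
    ≤-trans (∈-Decreasing-≤-head (subst Decreasing cₙ≡ cₙ-Decreasing) (subst (_ ∈_) cₙ≡ ℓ∈))
            (<lex-head-≤ (subst (_<lex _) cₙ≡ cₙ<))

  -- The first letter of the child word of v labels a child at least as high as the highest child of vₙ.
  childψ-above-top⇒h-≥ : ∀ v → cₙ <lex childψ G ψ v → hₙ ≤ h G v
  childψ-above-top⇒h-≥ v cₙ<cv = by-children (ch G vₙ) refl
    where
    by-children : ∀ cs → ch G vₙ ≡ cs → hₙ ≤ h G v
    by-children [] chvₙ≡ = subst (_≤ h G v) (sym (h-leaf chvₙ≡)) z≤n
    by-children (_ ∷ _) chvₙ≡
      with z , vₙ→z , hₙ≡ ← h-maxChild chvₙ≡
      with c , _ , cv≡ ← <lex⇒nonempty cₙ<cv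
      with y , v→y , refl ← ∈-childψ⁻ (subst (c ∈_) (sym cv≡) (here refl)) =
      subst (_≤ h G v) (sym hₙ≡) (<-≤-trans (s≤s (label-≤⇒h-≤ lz≤ly)) (h-arc v→y))
      where
      lz≤ly : label z ≤ label y
      lz≤ly = ∈-cₙ-≤-head (∈-childψ⁺ vₙ→z) (subst (cₙ <lex_) cv≡ cₙ<cv)

  childψ-≯-top : ∀ v → ¬ cₙ <lex childψ G ψ v
  childψ-≯-top v cₙ<cv =
    <⇒≱ (word-label (≤-antisym (h-≤-top v) (childψ-above-top⇒h-≥ v cₙ<cv)) cₙ<cv) (label-≤-top v)

  module Branching (a : Fin (# G)) (a∈A< : InA< G ψ a) (a≤last : LastGe cₙ (toℕ a)) where

    B : Graph
    B = branchGraph G ψ a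

    ch-B-top : ch B vₙ ≡ from a ∷ ch G vₙ
    ch-B-top with vₙ ≟ᶠ vₙ
    ... | yes _ = refl
    ... | no vₙ≢vₙ = ⊥-elim (vₙ≢vₙ refl)

    ch-B-other : ∀ {v} → v ≢ vₙ → ch B v ≡ ch G v
    ch-B-other {v} v≢vₙ with v ≟ᶠ vₙ
    ... | yes v≡vₙ = ⊥-elim (v≢vₙ v≡vₙ)
    ... | no _ = refl

    arc-B⁻ : ∀ {u v} → Arc B u v → (u ≡ vₙ × v ≡ from a) ⊎ Arc G u v
    arc-B⁻ {u} u→v with u ≟ᶠ vₙ | u→v
    ... | yes refl | here v≡ = inj₁ (refl , v≡)
    ... | yes refl | there u→v′ = inj₂ u→v′
    ... | no _ | u→v′ = inj₂ u→v′

    arc-B⁺ : ∀ {u v} → Arc G u v → Arc B u v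
    arc-B⁺ {u} u→v with u ≟ᶠ vₙ
    ... | yes refl = there u→v
    ... | no _ = u→v

    childψ-top-B : sortD (map label (from a ∷ ch G vₙ)) ≡ cₙ ∷ʳ toℕ a
    childψ-top-B = Decreasing-↭⇒≡ (sortD-Decreasing (map label (from a ∷ ch G vₙ))) (Decreasing-∷ʳ cₙ-Decreasing a≤last) (begin
      sortD (label (from a) ∷ map label (ch G vₙ))  ↭⟨ sortD-↭ (label (from a) ∷ map label (ch G vₙ)) ⟩
      label (from a) ∷ map label (ch G vₙ)          ≡⟨ cong (_∷ _) (label-from a) ⟩
      toℕ a ∷ map label (ch G vₙ)                   ↭⟨ ↭-prep _ (↭-sym (sortD-↭ _)) ⟩
      toℕ a ∷ cₙ                                   ↭⟨ ∷↭∷ʳ _ cₙ ⟩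
      cₙ ∷ʳ toℕ a                                  ∎)
      where open PermutationReasoning

    B-acyclic : Acyclic B
    B-acyclic = measure⇒Acyclic B label label-decreasing
      where
      label-decreasing : ∀ u v → Arc B u v → label v < label u
      label-decreasing u v u→v with arc-B⁻ {u} {v} u→v
      ... | inj₁ (refl , refl) = height-label a∈A<
      ... | inj₂ u→v′ = arc-label u→v′

    B-connected : Connected B
    B-connected u v = EqClosure.map arc-B⁺ (connected u v)

    ¬top-children-B : ∀ {v} → ¬ ((from a ∷ ch G vₙ) ↭ ch G v)
    ¬top-children-B {v} p = childψ-≯-top v (subst (cₙ <lex_) (trans (sym childψ-top-B) (sortD-↭-cong (map⁺ label p)))
                                                     (prefix-<lex cₙ))

    B-distinct : DistinctChildren B
    B-distinct u v p with u ≟ᶠ vₙ | v ≟ᶠ vₙ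
    ... | yes u≡vₙ | yes v≡vₙ = trans u≡vₙ (sym v≡vₙ)
    ... | yes refl | no _ = ⊥-elim (¬top-children-B p)
    ... | no _ | yes refl = ⊥-elim (¬top-children-B (↭-sym p))
    ... | no _ | no _ = distinct u v p

    B-isFDAG : IsFDAG B
    B-isFDAG = B-acyclic , B-connected , B-distinct

  module NewVertex (ws : List V) {w : V} (w∈ws : w ∈ ws) (fresh : ∀ v → ¬ (ws ↭ ch G v)) where

    H : Graph
    H = newVertexGraph G ψ ws

    arc-H⁺ : ∀ {u v} → Arc G u v → Arc H (suc u) (suc v)
    arc-H⁺ = ∈-map⁺ suc

    H-acyclic : Acyclic H
    H-acyclic = measure⇒Acyclic H μ μ-decreasing
      where
      μ : Fin (# H) → ℕ
      μ zero = # G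
      μ (suc v) = label v
      μ-decreasing : ∀ u v → Arc H u v → μ v < μ u
      μ-decreasing zero _ u→v with y , _ , refl ← ∈-map⁻ suc u→v = toℕ<n (to y)
      μ-decreasing (suc u) _ u→v with y , u→y , refl ← ∈-map⁻ suc u→v = arc-label u→y

    module Connection = IsEquivalence (EqClosure.isEquivalence (Arc H))

    new-connected : ∀ v → EqClosure (Arc H) zero (suc v)
    new-connected v = Connection.trans (return (∈-map⁺ suc w∈ws)) (gmap suc arc-H⁺ (connected w v))

    H-connected : Connected H
    H-connected zero zero = Connection.refl
    H-connected zero (suc v) = new-connected v
    H-connected (suc u) zero = Connection.sym (new-connected u)
    H-connected (suc u) (suc v) = gmap suc arc-H⁺ (connected u v)

    H-distinct : DistinctChildren H
    H-distinct zero zero _ = refl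
    H-distinct zero (suc v) p = ⊥-elim (fresh v (↭-map-injective⁻ suc Finₚ.suc-injective p))
    H-distinct (suc u) zero p = ⊥-elim (fresh u (↭-map-injective⁻ suc Finₚ.suc-injective (↭-sym p)))
    H-distinct (suc u) (suc v) p = cong suc (distinct u v (↭-map-injective⁻ suc Finₚ.suc-injective p))

    H-isFDAG : IsFDAG H
    H-isFDAG = H-acyclic , H-connected , H-distinct

  toℕ-mod : ∀ {k} → k < # G → toℕ (k mod # G) ≡ k
  toℕ-mod k<n = trans (toℕ-fromℕ< _) (m<n⇒m%n≡m k<n)

  -- Letters are labels, hence below #G, so reading them in Fin (#G) loses nothing.
  widenWord : Fin (# G) → List (Fin (# G))
  widenWord b = map (_mod # G) (minimalAbove (toℕ b) cₙ)

  ∈-minimalAbove-cₙ⁻ : ∀ {b : Fin (# G)} {ℓ} → ℓ ∈ minimalAbove (toℕ b) cₙ → (Σ V λ y → Arc G vₙ y × ℓ ≡ label y) ⊎ ℓ ≡ toℕ b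
  ∈-minimalAbove-cₙ⁻ {b} ℓ∈ with ∈-++⁻ (takeWhile (toℕ b ≤?_) cₙ) ℓ∈
  ... | inj₁ ℓ∈′ = inj₁ (∈-childψ⁻ (takeWhile-⊆ (toℕ b ≤?_) cₙ ℓ∈′))
  ... | inj₂ (here ℓ≡b) = inj₂ ℓ≡b

  ∈-minimalAbove-cₙ⇒< : ∀ {b : Fin (# G)} {ℓ} → ℓ ∈ minimalAbove (toℕ b) cₙ → ℓ < # G
  ∈-minimalAbove-cₙ⇒< {b} ℓ∈ with ∈-minimalAbove-cₙ⁻ {b} ℓ∈
  ... | inj₁ (y , _ , refl) = toℕ<n (to y)
  ... | inj₂ refl = toℕ<n b

  toℕ-widenWord : ∀ b → map toℕ (widenWord b) ≡ minimalAbove (toℕ b) cₙ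
  toℕ-widenWord b = trans (sym (map-∘ _))
    (trans (map-cong-local (All.tabulate λ ℓ∈ → toℕ-mod (∈-minimalAbove-cₙ⇒< {b} ℓ∈))) (map-id _))

  ∈-widenWord⁻ : ∀ {b x} → x ∈ widenWord b → (Σ V λ y → Arc G vₙ y × x ≡ to y) ⊎ x ≡ b
  ∈-widenWord⁻ {b} x∈ with ℓ , ℓ∈ , refl ← ∈-map⁻ (_mod # G) x∈ with ∈-minimalAbove-cₙ⁻ {b} ℓ∈
  ... | inj₁ (y , vₙ→y , refl) = inj₁ (y , vₙ→y , toℕ-injective (toℕ-mod (toℕ<n (to y))))
  ... | inj₂ refl = inj₂ (toℕ-injective (toℕ-mod (toℕ<n b)))

  widenWord-InA< : ∀ {b} → InA< G ψ b → All (InA< G ψ) (widenWord b)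
  widenWord-InA< {b} b∈A< = All.tabulate λ x∈ → case ∈-widenWord⁻ x∈ of λ where
    (inj₁ (y , vₙ→y , refl)) → subst (λ z → h G z < hₙ) (sym (strictlyInverseʳ y)) (h-arc vₙ→y)
    (inj₂ refl) → b∈A<

  widenWord-InW : ∀ {b} → InA< G ψ b → InW G ψ (widenWord b)
  widenWord-InW {b} b∈A< = subst Decreasing (sym (toℕ-widenWord b)) (minimalAbove-Decreasing (toℕ b) cₙ-Decreasing)
                        , widenWord-InA< b∈A<
                        , subst (cₙ <lex_) (sym (toℕ-widenWord b)) (<lex-minimalAbove (toℕ b) cₙ)

  widenWord-MinimalW : ∀ {b} → InA< G ψ b → MinimalW G ψ (widenWord b)
  widenWord-MinimalW {b} b∈A< = widenWord-InW b∈A< , λ (_ , _ , cₙ<) → ≮lex-SC-minimalAbove (toℕ b) cₙ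
    (subst (cₙ <lex_) (trans (sym (SC-map toℕ (widenWord b))) (cong SC (toℕ-widenWord b))) cₙ<)

  MinimalW⇒minimalAbove : ∀ {w} → MinimalW G ψ w → Σ ℕ λ k → map toℕ w ≡ minimalAbove k cₙ
  MinimalW⇒minimalAbove {w} ((w↘ , w∈A< , cₙ<w) , ¬SCw) = minimal⇒minimalAbove cₙ (map toℕ w) w↘ cₙ<w λ cₙ<SCw →
    ¬SCw (subst Decreasing (SC-map toℕ w) (Decreasing-SC w↘) , All-SC w∈A< , subst (cₙ <lex_) (SC-map toℕ w) cₙ<SCw)

  MinimalW⇒widenWord : ∀ {w} → MinimalW G ψ w → Σ (Fin (# G)) λ b → InA< G ψ b × w ≡ widenWord b
  MinimalW⇒widenWord {w} w-min@((_ , w∈A< , _) , _) with k , w≡ ← MinimalW⇒minimalAbove w-min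
    with b , b∈w , refl ← ∈-map⁻ toℕ (subst (k ∈_) (sym w≡) (∈-minimalAbove-last k cₙ)) =
    b , All.lookup w∈A< b∈w , map-injective toℕ-injective (trans w≡ (sym (toℕ-widenWord b)))

  elongation-fresh : ∀ {a} → InA= G ψ a → ∀ v → ¬ ([ from a ] ↭ ch G v)
  elongation-fresh a∈A= v p = <⇒≱ (subst (_< h G v) a∈A= (h-arc (∈-resp-↭ p (here refl)))) (h-≤-top v)

  widening-fresh : ∀ {w} → InW G ψ w → ∀ v → ¬ (map from w ↭ ch G v)
  widening-fresh {w} (w↘ , _ , cₙ<w) v p = childψ-≯-top v (subst (cₙ <lex_) (sym childψv) cₙ<w)
    where
    childψv : childψ G ψ v ≡ map toℕ w
    childψv = begin
      sortD (map label (ch G v))      ≡⟨ sortD-↭-cong (map⁺ label (↭-sym p)) ⟩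
      sortD (map label (map from w))  ≡⟨ cong sortD (trans (sym (map-∘ w)) (map-cong label-from w)) ⟩
      sortD (map toℕ w)               ≡⟨ sortD-Decreasing-id w↘ ⟩
      map toℕ w                       ∎
      where open ≡-Reasoning

  elongation-isFDAG : ∀ {a} → InA= G ψ a → IsFDAG (newVertexGraph G ψ [ from a ])
  elongation-isFDAG a∈A= = NewVertex.H-isFDAG [ _ ] (here refl) (elongation-fresh a∈A=)

  widening-isFDAG : ∀ {w} → InW G ψ w → IsFDAG (newVertexGraph G ψ (map from w))
  widening-isFDAG {w₀ ∷ w} w∈W = NewVertex.H-isFDAG (map from (w₀ ∷ w)) (here refl) (widening-fresh w∈W)

  newVertex-rigid : ∀ {ws₁ ws₂} → DistinctChildren (newVertexGraph G ψ ws₂) →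
                    Iso (newVertexGraph G ψ ws₁) (newVertexGraph G ψ ws₂) → ws₁ ↭ ws₂
  newVertex-rigid {ws₁} {ws₂} distinct₂ φ@(f , f-arcs) = ↭-map-injective⁻ suc Finₚ.suc-injective (begin
    map suc ws₁                        ≡⟨ trans (sym (map-cong old-fixed ws₁)) (map-∘ ws₁) ⟩
    map (Inverse.to f) (map suc ws₁)   ↭⟨ f-arcs zero ⟩
    ch H₂ (Inverse.to f zero)          ≡⟨ cong (ch H₂) new-fixed ⟩
    map suc ws₂                        ∎)
    where
    open PermutationReasoning
    H₂ : Graph
    H₂ = newVertexGraph G ψ ws₂
    μ : Fin (suc (# G)) → ℕ
    μ zero = 0
    μ (suc v) = h G v
    closed : ∀ {x y} → Σ V (λ v → x ≡ suc v) → y ∈ ch (newVertexGraph G ψ ws₁) x → Σ V (λ v → y ≡ suc v) × μ y < μ x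
    closed (v , refl) y∈ with y′ , v→y′ , refl ← ∈-map⁻ suc y∈ = (y′ , refl) , h-arc v→y′
    old-fixed : ∀ v → Inverse.to f (suc v) ≡ suc v
    old-fixed v = Iso-fixes φ distinct₂ (λ x → Σ V λ v → x ≡ suc v) μ (λ { (_ , refl) → refl }) closed (suc v) (v , refl)
    new-fixed : Inverse.to f zero ≡ zero
    new-fixed with Inverse.to f zero in e
    ... | zero = refl
    ... | suc v with () ← ↔-to-injective f (trans e (sym (old-fixed v)))

  branching-rigid : ∀ {a₁ a₂} (a₁∈A< : InA< G ψ a₁) (a₁≤ : LastGe cₙ (toℕ a₁)) (a₂∈A< : InA< G ψ a₂) (a₂≤ : LastGe cₙ (toℕ a₂)) →
                    Iso (branchGraph G ψ a₁) (branchGraph G ψ a₂) → a₁ ≡ a₂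
  branching-rigid {a₁} {a₂} a₁∈A< a₁≤ a₂∈A< a₂≤ φ@(f , f-arcs) =
    ↔-from-injective ψ (∷-↭-cancelʳ (ch G vₙ) (begin
      from a₁ ∷ ch G vₙ                   ≡⟨ sym (trans (map-cong-local (All.tabulate others-fixed)) (map-id _)) ⟩
      map (Inverse.to f) (from a₁ ∷ ch G vₙ) ≡⟨ cong (map (Inverse.to f)) (sym B₁.ch-B-top) ⟩
      map (Inverse.to f) (ch B₁.B vₙ)     ↭⟨ f-arcs vₙ ⟩
      ch B₂.B (Inverse.to f vₙ)           ≡⟨ cong (ch B₂.B) top-fixed ⟩
      ch B₂.B vₙ                          ≡⟨ B₂.ch-B-top ⟩
      from a₂ ∷ ch G vₙ                   ∎))
    where
    open PermutationReasoning
    module B₁ = Branching a₁ a₁∈A< a₁≤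
    module B₂ = Branching a₂ a₂∈A< a₂≤
    closed : ∀ {v y} → v ≢ vₙ → y ∈ ch B₁.B v → y ≢ vₙ × h G y < h G v
    closed {v} v≢vₙ y∈ = let v→y = subst (_ ∈_) (B₁.ch-B-other v≢vₙ) y∈ in
      (λ { refl → ¬arc-to-top v→y }) , h-arc v→y
    fixed : ∀ v → v ≢ vₙ → Inverse.to f v ≡ v
    fixed = Iso-fixes φ B₂.B-distinct (_≢ vₙ) (h G) (λ v≢vₙ → trans (B₁.ch-B-other v≢vₙ) (sym (B₂.ch-B-other v≢vₙ))) closed
    top-fixed : Inverse.to f vₙ ≡ vₙ
    top-fixed with Inverse.to f vₙ ≟ᶠ vₙ
    ... | yes e = e
    ... | no t≢vₙ = ⊥-elim (t≢vₙ (↔-to-injective f (fixed _ t≢vₙ)))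
    others-fixed : ∀ {y} → y ∈ from a₁ ∷ ch G vₙ → Inverse.to f y ≡ y
    others-fixed (here refl) = fixed _ λ e → <-irrefl (cong (h G) e) a₁∈A<
    others-fixed (there vₙ→y) = fixed _ λ { refl → ¬arc-to-top vₙ→y }

-- Counting the successors

AllPairs⇒Pairwise≇ : ∀ {Es} → AllPairs (λ E E′ → ¬ Iso (gr E) (gr E′)) Es → Pairwise≇ Es
AllPairs⇒Pairwise≇ [] = []
AllPairs⇒Pairwise≇ (≇Es ∷ pairwise) = ≇Es ∷ AllPairs⇒Pairwise≇ pairwise

module Successors (G : Graph) (acyclic : Acyclic G) (connected : Connected G) (distinct : DistinctChildren G)
  (ψ : Fin (# G) ↔ Fin (# G)) (canonical : IsCanonical G ψ) where

  open Expansion G acyclic connected distinct ψ canonical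
  open Inverse ψ using (to; from)

  D : FDAG
  D = fdag G (acyclic , connected , distinct)

  labels : List (Fin (# G))
  labels = allFin (# G)

  InA<? : Decidable (InA< G ψ)
  InA<? b = h G (from b) <? hₙ

  ∉A<⇒∈A= : ∀ {b} → ¬ InA< G ψ b → InA= G ψ b
  ∉A<⇒∈A= b∉A< = ≤-antisym (h-≤-top _) (≮⇒≥ b∉A<)

  newChildren : ∀ b → Dec (InA< G ψ b) → List V
  newChildren b (yes _) = map from (widenWord b)
  newChildren b (no _) = [ from b ]

  newChildren-isFDAG : ∀ b d → IsFDAG (newVertexGraph G ψ (newChildren b d))
  newChildren-isFDAG b (yes b∈A<) = widening-isFDAG (widenWord-InW b∈A<)
  newChildren-isFDAG b (no b∉A<) = elongation-isFDAG (∉A<⇒∈A= b∉A<)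

  newVertexSucc : ∀ b → Dec (InA< G ψ b) → FDAG
  newVertexSucc b d = fdag (newVertexGraph G ψ (newChildren b d)) (newChildren-isFDAG b d)

  Branchable : Fin (# G) → Set
  Branchable b = InA< G ψ b × LastGe cₙ (toℕ b)

  Branchable? : Decidable Branchable
  Branchable? b = InA<? b ×-dec lastGe? cₙ (toℕ b)

  branchSucc : Σ (Fin (# G)) Branchable → FDAG
  branchSucc (b , b∈A< , b≤) = fdag _ (Branching.B-isFDAG b b∈A< b≤)

  branchables : List (Σ (Fin (# G)) Branchable)
  branchables = select Branchable? labels

  newSucc : Fin (# G) → FDAG
  newSucc b = newVertexSucc b (InA<? b)

  successors : List FDAG
  successors = map newSucc labels ++ map branchSucc branchables

  newVertexSucc-Succ : ∀ b d → Succ D (newVertexSucc b d)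
  newVertexSucc-Succ b (yes b∈A<) = ψ , canonical , _ , widening _ (widenWord-MinimalW b∈A<) , Iso-reflexive λ _ → refl
  newVertexSucc-Succ b (no b∉A<) = ψ , canonical , _ , elongation b (∉A<⇒∈A= b∉A<) , Iso-reflexive λ _ → refl

  branchSucc-Succ : ∀ q → Succ D (branchSucc q)
  branchSucc-Succ (b , b∈A< , b≤) = ψ , canonical , _ , branching b b∈A< b≤ , Iso-reflexive λ _ → refl

  successors-Succ : All (Succ D) successors
  successors-Succ = Allₚ.++⁺ (Allₚ.map⁺ {xs = labels} {f = newSucc} (All.tabulate λ {b} _ → newVertexSucc-Succ b (InA<? b)))
                            (Allₚ.map⁺ {xs = branchables} {f = branchSucc} (All.tabulate λ {q} _ → branchSucc-Succ q))

  ¬elongation↭widening : ∀ {b b′} → InA= G ψ b → InA< G ψ b′ → ¬ ([ from b ] ↭ map from (widenWord b′))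
  ¬elongation↭widening b∈A= b′∈A< p with x , x∈w , from-b≡ ← ∈-map⁻ from (∈-resp-↭ p (here refl)) =
    <-irrefl (trans (cong (h G) (sym from-b≡)) b∈A=) (All.lookup (widenWord-InA< b′∈A<) x∈w)

  newChildren-injective : ∀ b b′ d d′ → newChildren b d ↭ newChildren b′ d′ → b ≡ b′
  newChildren-injective b b′ (yes b∈A<) (yes b′∈A<) p =
    toℕ-injective (minimalAbove-injective cₙ (begin
      minimalAbove (toℕ b) cₙ     ≡⟨ sym (toℕ-widenWord b) ⟩
      map toℕ (widenWord b)       ≡⟨ Decreasing-↭⇒≡ (proj₁ (widenWord-InW b∈A<)) (proj₁ (widenWord-InW b′∈A<))
                                       (map⁺ toℕ (↭-map-injective⁻ from (↔-from-injective ψ) p)) ⟩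
      map toℕ (widenWord b′)      ≡⟨ toℕ-widenWord b′ ⟩
      minimalAbove (toℕ b′) cₙ    ∎))
    where open ≡-Reasoning
  newChildren-injective b b′ (no _) (no _) p = ↔-from-injective ψ (∷-injectiveˡ (sym (↭-singleton-inv (↭-sym p))))
  newChildren-injective b b′ (no b∉A<) (yes b′∈A<) p = ⊥-elim (¬elongation↭widening (∉A<⇒∈A= b∉A<) b′∈A< p)
  newChildren-injective b b′ (yes b∈A<) (no b′∉A<) p = ⊥-elim (¬elongation↭widening (∉A<⇒∈A= b′∉A<) b∈A< (↭-sym p))

  newVertexSucc-injective : ∀ b b′ d d′ → Iso (gr (newVertexSucc b d)) (gr (newVertexSucc b′ d′)) → b ≡ b′
  newVertexSucc-injective b b′ d d′ φ =
    newChildren-injective b b′ d d′ (newVertex-rigid (proj₂ (proj₂ (newChildren-isFDAG b′ d′))) φ)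

  branchSucc-injective : ∀ q q′ → Iso (gr (branchSucc q)) (gr (branchSucc q′)) → proj₁ q ≡ proj₁ q′
  branchSucc-injective (_ , b∈A< , b≤) (_ , b′∈A< , b′≤) = branching-rigid b∈A< b≤ b′∈A< b′≤

  newVertexSucc≇branchSucc : ∀ b d q → ¬ Iso (gr (newVertexSucc b d)) (gr (branchSucc q))
  newVertexSucc≇branchSucc b d q φ = 1+n≢n (Iso⇒#≡ {gr (newVertexSucc b d)} {gr (branchSucc q)} φ)

  successors-Pairwise≇ : Pairwise≇ successors
  successors-Pairwise≇ = AllPairs⇒Pairwise≇ (AllPairsₚ.++⁺
    (AllPairsₚ.map⁺ {f = newSucc} {xs = labels} (AllPairs.map (λ {b} {b′} b≢b′ φ → b≢b′ (newVertexSucc-injective b b′ (InA<? b) (InA<? b′) φ)) (allFin⁺ (# G))))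
    (AllPairsₚ.map⁺ {f = branchSucc} {xs = branchables} (AllPairs.map (λ {q} {q′} b≢b′ φ → b≢b′ (branchSucc-injective q q′ φ))
      (AllPairs-select Branchable? (allFin⁺ (# G)))))
    (Allₚ.map⁺ {xs = labels} {f = newSucc} (All.tabulate λ {b} _ →
      Allₚ.map⁺ {xs = branchables} {f = branchSucc} (All.tabulate λ {q} _ → newVertexSucc≇branchSucc b (InA<? b) q))))

  module Transport {ψ′ : Fin (# G) ↔ Fin (# G)} (canonical′ : IsCanonical G ψ′) where

    open CanonicalUniqueness G acyclic distinct ψ′ ψ canonical′ canonical using (same-from; same-to) public
    module E′ = Expansion G acyclic connected distinct ψ′ canonical′

    top≡ : top G ψ′ ≡ vₙ
    top≡ = same-from _

    cₙ≡ : childψ G ψ′ (top G ψ′) ≡ cₙ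
    cₙ≡ = trans (cong (childψ G ψ′) top≡) (cong sortD (map-cong (λ v → cong toℕ (same-to v)) (ch G vₙ)))

    widenWord-transport : ∀ b → E′.widenWord b ≡ widenWord b
    widenWord-transport b = cong (λ c → map (_mod # G) (minimalAbove (toℕ b) c)) cₙ≡

    InA<-transport : ∀ {a} → InA< G ψ′ a → InA< G ψ a
    InA<-transport = subst₂ (λ x y → h G x < h G y) (same-from _) top≡

    InA=-transport : ∀ {a} → InA= G ψ′ a → InA= G ψ a
    InA=-transport = subst₂ (λ x y → h G x ≡ h G y) (same-from _) top≡

    branchGraph-transport : ∀ {a} (a∈A< : InA< G ψ′ a) (a≤ : LastGe E′.cₙ (toℕ a)) →
                            Iso (branchGraph G ψ′ a) (branchGraph G ψ a)
    branchGraph-transport {a} a∈A< a≤ = Iso-reflexive same-children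
      where
      module B′ = E′.Branching a a∈A< a≤
      module B = Branching a (InA<-transport a∈A<) (subst (λ c → LastGe c (toℕ a)) cₙ≡ a≤)
      same-children-by : ∀ {v} → Dec (v ≡ vₙ) → ch B′.B v ≡ ch B.B v
      same-children-by (yes refl) = begin
        ch B′.B vₙ                          ≡⟨ subst (λ t → ch B′.B t ≡ Inverse.from ψ′ a ∷ ch G t) top≡ B′.ch-B-top ⟩
        Inverse.from ψ′ a ∷ ch G vₙ         ≡⟨ cong (_∷ ch G vₙ) (same-from a) ⟩
        from a ∷ ch G vₙ                    ≡⟨ B.ch-B-top ⟨
        ch B.B vₙ                           ∎
        where open ≡-Reasoning
      same-children-by (no v≢vₙ) = trans (B′.ch-B-other (λ v≡ → v≢vₙ (trans v≡ top≡))) (sym (B.ch-B-other v≢vₙ))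
      same-children : ∀ v → ch B′.B v ≡ ch B.B v
      same-children v = same-children-by (v ≟ᶠ vₙ)

    newVertexGraph-transport : ∀ {ws ws′} → ws ≡ ws′ → Iso (newVertexGraph G ψ′ ws) (newVertexGraph G ψ ws′)
    newVertexGraph-transport {ws} refl = Iso-reflexive {c₂ = ch (newVertexGraph G ψ ws)} λ { zero → refl ; (suc v) → refl }

  successors-complete : ∀ E → Succ D E → Any (λ E′ → Iso (gr E) (gr E′)) successors
  successors-complete E (ψ′ , canonical′ , G′ , rule , G′≅E) = from-rule rule (Iso-sym G′≅E)
    where
    open Transport canonical′

    newSucc-member : ∀ b → (∀ d → Iso (gr E) (gr (newVertexSucc b d))) → Any (λ E′ → Iso (gr E) (gr E′)) successors
    newSucc-member b E≅ = Anyₚ.++⁺ˡ (Anyₚ.map⁺ (Any.map (λ { refl → E≅ (InA<? b) }) (∈-allFin b)))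

    from-rule : ∀ {G′} → Rule G ψ′ G′ → Iso (gr E) G′ → Any (λ E′ → Iso (gr E) (gr E′)) successors
    from-rule (branching a a∈A< a≤) E≅G′
      with _ , a∈ ← ∈-select⁺ Branchable? (∈-allFin a) (InA<-transport a∈A< , subst (λ c → LastGe c (toℕ a)) cₙ≡ a≤) =
      Anyₚ.++⁺ʳ (map newSucc labels) (Anyₚ.map⁺ (Any.map (λ { refl → Iso-trans {K = branchGraph G ψ a} E≅G′ (branchGraph-transport a∈A< a≤) }) a∈))
    from-rule (elongation a a∈A=) E≅G′ = newSucc-member a λ where
      (yes a∈A<) → ⊥-elim (<-irrefl (InA=-transport a∈A=) a∈A<)
      (no _) → Iso-trans {K = newVertexGraph G ψ [ from a ]} E≅G′ (newVertexGraph-transport (cong [_] (same-from a)))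
    from-rule (widening w w-min) E≅G′ with b , b∈A<′ , refl ← E′.MinimalW⇒widenWord w-min = newSucc-member b λ where
      (yes _) → Iso-trans {K = newVertexGraph G ψ (map from (widenWord b))} E≅G′
                  (newVertexGraph-transport (trans (map-cong same-from _) (cong (map from) (widenWord-transport b))))
      (no b∉A<) → ⊥-elim (b∉A< (InA<-transport b∈A<′))

  successors-NumSucc : NumSucc D (length successors)
  successors-NumSucc = successors , refl , successors-Succ , successors-Pairwise≇ , successors-complete

  length-successors : length successors ≡ # G + length branchables
  length-successors = begin
    length (map newSucc labels ++ map branchSucc branchables)          ≡⟨ length-++ (map newSucc labels) ⟩
    length (map newSucc labels) + length (map branchSucc branchables) ≡⟨ cong₂ _+_ (length-map newSucc labels) (length-map branchSucc branchables) ⟩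
    length labels + length branchables                                ≡⟨ cong (_+ length branchables) (length-tabulate id) ⟩
    # G + length branchables                                          ∎
    where open ≡-Reasoning

  #≤successors : # G ≤ length successors
  #≤successors = subst (# G ≤_) (sym length-successors) (m≤m+n (# G) (length branchables))

  successors≤2# : length successors ≤ 2 * # G
  successors≤2# = begin
    length successors            ≡⟨ length-successors ⟩
    # G + length branchables     ≤⟨ +-monoʳ-≤ (# G) (length-select Branchable? labels) ⟩
    # G + length labels          ≡⟨ cong (# G +_) (length-tabulate id) ⟩
    # G + # G                    ≡⟨ cong (# G +_) (sym (+-identityʳ (# G))) ⟩
    2 * # G                      ∎
    where open ≤-Reasoning

theorem3p3 : Σ ℕ λ k → Σ ℕ λ C → 0 < k ×
    ((D : FDAG) → Σ ℕ λ N → NumSucc D N × (# gr D ≤ k * N) × (N ≤ C * # gr D))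
theorem3p3 = 1 , 2 , s≤s z≤n , λ where
  (fdag G (acyclic , connected , distinct)) →
    let open CanonicalExistence G acyclic distinct using (ψ₀; ψ₀-canonical)
        open Successors G acyclic connected distinct ψ₀ ψ₀-canonical
    in length successors , successors-NumSucc
     , subst (# G ≤_) (sym (*-identityˡ _)) #≤successors , successors≤2#
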